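{- Let $\mathcal{V}=\{x_1,\dots,x_d\}$ and let $\eta_s:\mathcal{V}\to\mathbb{Z}[\mathcal{V}]$ be a solvable update with partition $\mathcal{S}_1,\dots,\mathcal{S}_m$ and matrices $A_{\mathcal{S}_i}$. For each block $\mathcal{S}$ let $P_{\mathcal{S}}$ be an invertible matrix over $\mathbb{A}$ such that $J(A_{\mathcal{S}})=P_{\mathcal{S}}\cdot A_{\mathcal{S}}\cdot P_{\mathcal{S}}^{ -1}$ is the Jordan normal form of $A_{\mathcal{S}}$, and let $\vartheta:\mathcal{V}\to\mathbb{A}[\mathcal{V}]$ be the automorphism defined blockwise by $\vec{\vartheta}_{\mathcal{S}}=P_{\mathcal{S}}\cdot\vec{x}_{\mathcal{S}}$ (i.e., the vector of the $\vartheta(x_j)$, $j\in\mathcal{S}$, equals $P_{\mathcal{S}}\cdot \vec{x}_{\mathcal{S}}$), such that $\eta_t=\vartheta^{ -1}\circ\eta_s\circ\vartheta$ is a twn-update. If $\mathrm{cl}_t$ (mapping each $x_i$ to $\mathrm{cl}_t(x_i)$) is a closed form of $\eta_t$ with start value $n_0$, then $\mathrm{cl}_s=\vartheta\circ\mathrm{cl}_t\circ\vartheta^{ -1}$, i.e. $\mathrm{cl}_s(v)=\vartheta^{ -1}(v)\,[w/\mathrm{cl}_t(w)\mid w\in\mathcal{V}]\,[w/\vartheta(w)\mid w\in\mathcal{V}]$ for all $v\in\mathcal{V}$, is a closed form of $\eta_s$ with start value $n_0$.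
   Context: $\mathbb{A}$ denotes the field of algebraic numbers. An update $\eta:\mathcal{V}\to\mathbb{Z}[\mathcal{V}]$ is solvable if there is a partition $\mathcal{S}_1,\dots,\mathcal{S}_m$ of $\mathcal{V}$ such that for each $i$ the vector $\vec{\eta}_{\mathcal{S}_i}$ of all $\eta(x_j)$, $j\in\mathcal{S}_i$, equals $A_{\mathcal{S}_i}\vec{x}_{\mathcal{S}_i}+\vec{p}_{\mathcal{S}_i}$ with $A_{\mathcal{S}_i}\in\mathbb{Z}^{|\mathcal{S}_i|\times|\mathcal{S}_i|}$ and $\vec p_{\mathcal{S}_i}$ a vector of polynomials in $\mathbb{Z}[\mathcal{S}_1\cup\dots\cup\mathcal{S}_{i-1}]$. An update $\eta:\mathcal{V}\to\mathbb{A}[\mathcal{V}]$ is twn if $\eta(x_i)=c_i x_i+p_i$ with $c_i\in\mathbb{A}$, $p_i\in\mathbb{A}[x_1,\dots,x_{i-1}]$ for all $i$. Updates are applied to expressions by substituting each variable $v$ by $\eta(v)$; composition is $(\eta_1\circ\eta_2)(v)=\eta_2(v)[w/\eta_1(w)\mid w\in\mathcal{V}]$, and $\eta^n$ is the $n$-fold application. The set of poly-exponential expressions is $\mathbb{PE}=\{\sum_{j=1}^{\ell}p_j\cdot n^{a_j}\cdot b_j^n\mid \ell,a_j\in\mathbb{N},\,b_j\in\mathbb{A},\,p_j\in\mathbb{A}[\mathcal{V}]\}$ with a distinguished variable $n$. An expression $\mathrm{cl}(x_i)\in\mathbb{PE}$ is a closed form for $x_i$ (w.r.t. $\eta$) with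 start value $n_0\in\mathbb{N}$ if for all $\sigma:\mathcal{V}\cup\{n\}\to\mathbb{Z}$ with $\sigma(n)\ge n_0$ we have $\sigma(\mathrm{cl}(x_i))=\sigma(\eta^n(x_i))$ (with $n$ instantiated by $\sigma(n)$); $\mathrm{cl}$ is a closed form of $\eta$ with start value $n_0$ if this holds for every $x_i$. -}

module Defs where

open import Level using (0ℓ)
open import Algebra.Bundles using (CommutativeRing)
open import Data.Nat using (ℕ; zero; suc)
open import Data.Integer as ℤ using (ℤ; +_; -[1+_])
open import Data.Fin as Fin using (Fin; zero; suc)
open import Data.List using (List; []; _∷_; _++_; [_]; map)
open import Data.List.Relation.Unary.Any using (Any)
open import Data.Product using (Σ; ∃; _×_; _,_)
open import Data.Sum using (_⊎_)
open import Data.Unit using (⊤)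
open import Data.Empty using (⊥)
open import Function using (_∘_)
open import Relation.Nullary using (¬_; yes; no)
open import Relation.Binary using (Decidable)
open import Relation.Binary.PropositionalEquality using (_≡_; _≢_)

infixl 6 _⊕_
infixl 7 _⊗_

data Term (C : Set) (d : ℕ) : Set where
  con     : C → Term C d
  var     : Fin d → Term C d
  _⊕_ _⊗_ : Term C d → Term C d → Term C d

Update : Set → ℕ → Set
Update C d = Fin d → Term C d

mapT : ∀ {C D d} → (C → D) → Term C d → Term D d
mapT f (con c)  = con (f c)
mapT f (var x)  = var x
mapT f (s ⊕ t)  = mapT f s ⊕ mapT f t
mapT f (s ⊗ t)  = mapT f s ⊗ mapT f t

substT : ∀ {C d} → Update C d → Term C d → Term C d
substT η (con c) = con c
substT η (var x) = η x
substT η (s ⊕ t) = substT η s ⊕ substT η t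
substT η (s ⊗ t) = substT η s ⊗ substT η t

-- (η₁ ∘ η₂)(v) = η₂(v) [ w / η₁(w) ]
_⊙_ : ∀ {C d} → Update C d → Update C d → Update C d
(η₁ ⊙ η₂) v = substT η₁ (η₂ v)

powU : ∀ {C d} → Update C d → ℕ → Update C d
powU η zero    v = var v
powU η (suc n) v = substT η (powU η n v)

OnlyVars : ∀ {C d} → (Fin d → Set) → Term C d → Set
OnlyVars Q (con c) = ⊤
OnlyVars Q (var x) = Q x
OnlyVars Q (s ⊕ t) = OnlyVars Q s × OnlyVars Q t
OnlyVars Q (s ⊗ t) = OnlyVars Q s × OnlyVars Q t

bigT : ∀ {C d} → C → (n : ℕ) → (Fin n → Term C d) → Term C d
bigT z zero    f = con z
bigT z (suc n) f = f zero ⊕ bigT z n (f ∘ suc)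

-- blockwise linear update: x_j ↦ Σ_{k ∈ S_{blk j}} M j k · x_k
blockLin : ∀ {C d m} → C → (Fin d → Fin m) → (Fin d → Fin d → C) → Update C d
blockLin {d = d} z blk M j =
  bigT z d (λ k → sel (blk k Fin.≟ blk j) k)
  where
  sel : ∀ {P : Set} → Relation.Nullary.Dec P → Fin d → Term _ d
  sel (yes _) k = con (M j k) ⊗ var k
  sel (no _)  k = con z

data PE (C : Set) (d : ℕ) : Set where
  con     : C → PE C d
  var     : Fin d → PE C d
  nb      : ℕ → C → PE C d          -- nb a b  =  n^a · b^n
  _⊕_ _⊗_ : PE C d → PE C d → PE C d

toPE : ∀ {C d} → Term C d → PE C d
toPE (con c) = con c
toPE (var x) = var x
toPE (s ⊕ t) = toPE s ⊕ toPE t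
toPE (s ⊗ t) = toPE s ⊗ toPE t

substPE : ∀ {C d} → (Fin d → PE C d) → PE C d → PE C d
substPE f (con c)  = con c
substPE f (var x)  = f x
substPE f (nb a b) = nb a b
substPE f (s ⊕ t)  = substPE f s ⊕ substPE f t
substPE f (s ⊗ t)  = substPE f s ⊗ substPE f t

evalℤ : ∀ {d} → (Fin d → ℤ) → Term ℤ d → ℤ
evalℤ σ (con c) = c
evalℤ σ (var x) = σ x
evalℤ σ (s ⊕ t) = evalℤ σ s ℤ.+ evalℤ σ t
evalℤ σ (s ⊗ t) = evalℤ σ s ℤ.* evalℤ σ t

-- The field 𝔸 of algebraic numbers, axiomatised up to isomorphism:
-- an algebraically closed field of characteristic 0 all of whose
-- elements are algebraic over ℤ (equivalently ℚ); any two such fields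
-- are isomorphic, so this pins down 𝔸.

module Ops (R : CommutativeRing 0ℓ 0ℓ) where
  open CommutativeRing R

  fromℕ : ℕ → Carrier
  fromℕ zero    = 0#
  fromℕ (suc k) = 1# + fromℕ k

  fromℤ : ℤ → Carrier
  fromℤ (+ k)      = fromℕ k
  fromℤ -[1+ k ]   = - fromℕ (suc k)

  _^ᴬ_ : Carrier → ℕ → Carrier
  x ^ᴬ zero  = 1#
  x ^ᴬ suc k = x * (x ^ᴬ k)

  -- univariate polynomial with coefficient list c₀ ∷ c₁ ∷ … (low to high)
  evalU : List Carrier → Carrier → Carrier
  evalU []       x = 0#
  evalU (c ∷ cs) x = c + x * evalU cs x

record AlgebraicNumbers : Set₁ where
  field
    𝔸ring : CommutativeRing 0ℓ 0ℓ
  open CommutativeRing 𝔸ring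
  open Ops 𝔸ring
  field
    _≟ᴬ_          : Decidable _≈_
    1≉0           : ¬ (1# ≈ 0#)
    inverse       : ∀ x → ¬ (x ≈ 0#) → ∃ λ y → x * y ≈ 1#
    char0         : ∀ k → ¬ (fromℕ (suc k) ≈ 0#)
    algClosed     : ∀ (c : Carrier) (cs : List Carrier) (a : Carrier) →
                    ¬ (a ≈ 0#) → ∃ λ x → evalU (c ∷ cs ++ [ a ]) x ≈ 0#
    algebraic     : ∀ x → ∃ λ (zs : List ℤ) →
                    Any (λ z → z ≢ + 0) zs × evalU (map fromℤ zs) x ≈ 0#

module WithA (𝔸 : AlgebraicNumbers) where
  open AlgebraicNumbers 𝔸
  open CommutativeRing 𝔸ring public using (Carrier; _≈_; _+_; _*_; -_; 0#; 1#)
  open Ops 𝔸ring public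

  eval : ∀ {d} → (Fin d → Carrier) → Term Carrier d → Carrier
  eval σ (con c) = c
  eval σ (var x) = σ x
  eval σ (s ⊕ t) = eval σ s + eval σ t
  eval σ (s ⊗ t) = eval σ s * eval σ t

  evalPE : ∀ {d} → (Fin d → Carrier) → ℕ → PE Carrier d → Carrier
  evalPE σ n (con c)  = c
  evalPE σ n (var x)  = σ x
  evalPE σ n (nb a b) = (fromℕ n ^ᴬ a) * (b ^ᴬ n)
  evalPE σ n (s ⊕ t)  = evalPE σ n s + evalPE σ n t
  evalPE σ n (s ⊗ t)  = evalPE σ n s * evalPE σ n t

  bsum : ∀ {d m} → (Fin d → Fin m) → Fin m → (Fin d → Carrier) → Carrier
  bsum {zero}  blk i f = 0#
  bsum {suc d} blk i f with blk zero Fin.≟ i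
  ... | yes _ = f zero + bsum (blk ∘ suc) i (f ∘ suc)
  ... | no _  = bsum (blk ∘ suc) i (f ∘ suc)

  δ : ∀ {d} → Fin d → Fin d → Carrier
  δ j k with j Fin.≟ k
  ... | yes _ = 1#
  ... | no _  = 0#

  BlockInverse : ∀ {d m} → (Fin d → Fin m) → (P Pinv : Fin d → Fin d → Carrier) → Set
  BlockInverse blk P Pinv = ∀ j k → blk j ≡ blk k →
    (bsum blk (blk j) (λ l → P j l * Pinv l k) ≈ δ j k) ×
    (bsum blk (blk j) (λ l → Pinv j l * P l k) ≈ δ j k)

  conj : ∀ {d m} → (Fin d → Fin m) → (P : Fin d → Fin d → Carrier) →
         (A : Fin d → Fin d → ℤ) → (Pinv : Fin d → Fin d → Carrier) →
         Fin d → Fin d → Carrier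
  conj blk P A Pinv j k =
    bsum blk (blk j) (λ l → bsum blk (blk j) (λ l' → P j l * fromℤ (A l l') * Pinv l' k))

  NextIn : ∀ {d m} → (Fin d → Fin m) → Fin d → Fin d → Set
  NextIn blk j k = (j Fin.< k) × (blk j ≡ blk k) ×
    (∀ l → j Fin.< l → l Fin.< k → blk l ≢ blk j)

  -- J restricted to block i is in Jordan normal form, with the 1s on the
  -- superdiagonal (upper = true) or on the subdiagonal (upper = false)
  JordanUpper : ∀ {d m} → (Fin d → Fin m) → (Fin d → Fin d → Carrier) → Fin m → Set
  JordanUpper blk J i =
    (∀ j k → blk j ≡ i → blk k ≡ i → j ≢ k → ¬ NextIn blk j k → J j k ≈ 0#) ×
    (∀ j k → blk j ≡ i → NextIn blk j k → (J j k ≈ 0#) ⊎ ((J j k ≈ 1#) × (J j j ≈ J k k)))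

  IsJordanNF : ∀ {d m} → (Fin d → Fin m) → (Fin d → Fin d → Carrier) → Fin m → Set
  IsJordanNF blk J i = JordanUpper blk J i ⊎ JordanUpper blk (λ j k → J k j) i

  IsPartition : ∀ {d m} → (Fin d → Fin m) → Set
  IsPartition {d} {m} blk = ∀ (i : Fin m) → ∃ λ (j : Fin d) → blk j ≡ i

  SolvableWith : ∀ {d m} → (Fin d → Fin m) → Update ℤ d →
                 (Fin d → Fin d → ℤ) → (Fin d → Term ℤ d) → Set
  SolvableWith blk η A p = ∀ j →
    (∀ (σ : Fin _ → ℤ) → evalℤ σ (η j) ≡ evalℤ σ (blockLin (+ 0) blk A j ⊕ p j)) ×
    OnlyVars (λ k → blk k Fin.< blk j) (p j)

  -- twn-update (polynomial equality = equality as functions 𝔸^d → 𝔸)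
  IsTwn : ∀ {d} → Update Carrier d → Set
  IsTwn η = ∀ i → ∃ λ (c : Carrier) → ∃ λ (q : Term Carrier _) →
    OnlyVars (λ k → k Fin.< i) q ×
    (∀ (σ : Fin _ → Carrier) → eval σ (η i) ≈ eval σ (con c ⊗ var i ⊕ q))

  IsClosedForm : ∀ {d} → Update Carrier d → (Fin d → PE Carrier d) → ℕ → Set
  IsClosedForm η cl n₀ = ∀ (σ : Fin _ → ℤ) (n : ℕ) → n₀ Data.Nat.≤ n → ∀ i →
    evalPE (fromℤ ∘ σ) n (cl i) ≈ eval (fromℤ ∘ σ) (powU η n i)

  ϑ : ∀ {d m} → (Fin d → Fin m) → (Fin d → Fin d → Carrier) → Update Carrier d
  ϑ blk P = blockLin 0# blk P

  ηt : ∀ {d m} → (Fin d → Fin m) → (P Pinv : Fin d → Fin d → Carrier) →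
       Update ℤ d → Update Carrier d
  ηt blk P Pinv ηs = (ϑ blk Pinv ⊙ (mapT fromℤ ∘ ηs)) ⊙ ϑ blk P

  cls : ∀ {d m} → (Fin d → Fin m) → (P Pinv : Fin d → Fin d → Carrier) →
        (Fin d → PE Carrier d) → Fin d → PE Carrier d
  cls blk P Pinv clt v =
    substPE (toPE ∘ ϑ blk P) (substPE clt (toPE (ϑ blk Pinv v)))

{-# OPTIONS --safe #-}
module Submission where

-- ϑ conjugates η_t into η_s, so semantically η_sⁿ = ϑ ∘ η_tⁿ ∘ ϑ⁻¹, and at an integer point σ the
-- expression cl_s evaluates to ϑ⁻¹ applied to cl_t at the algebraic point ϑ(σ). The hypothesis on
-- cl_t only covers integer points, but both sides of a closed-form identity are polynomials in the
-- start values, and over a field of characteristic 0 a polynomial identity on ℕ^d holds on all of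
-- 𝔸^d: fix the variables one at a time and use that a univariate polynomial vanishing on ℕ is zero.

open import Defs
open import Data.Nat using (ℕ)
open import Data.Integer using (ℤ)
open import Data.Fin using (Fin)
open import Function using (_∘_)

open import Level using (0ℓ)
open import Algebra.Bundles using (CommutativeRing)
import Data.Integer as ℤ
open import Data.Nat as ℕ using (zero; suc)
import Data.Nat.Properties as ℕ
open import Data.Fin as Fin using (zero; suc; punchIn)
open import Data.Fin.Properties using (punchInᵢ≢i)
open import Data.Vec.Functional as Vector using (head; tail)
open import Data.List using (List; []; _∷_; length; map)
open import Data.Product using (∃; _,_; proj₂)
open import Relation.Nullary using (Dec; yes; no; contradiction)
open import Relation.Binary.PropositionalEquality as ≡ using (_≡_; _≢_)

module Univariate (R : CommutativeRing 0ℓ 0ℓ) where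
  open CommutativeRing R
  open Ops R
  open import Algebra.Properties.Ring ring using (+-identityʳ-unique; x∙y⁻¹≈ε⇒x≈y; x≈y⇒x∙y⁻¹≈ε; -1*x≈-x)
  open import Algebra.Solver.Ring.NaturalCoefficients.Default commutativeSemiring
    using (solve; _:+_; _:*_; _:=_)
  open import Relation.Binary.Reasoning.Setoid setoid

  infixl 6 _+ₚ_
  infixl 7 _*ₚ_

  _+ₚ_ : List Carrier → List Carrier → List Carrier
  []      +ₚ q       = q
  (a ∷ p) +ₚ []      = a ∷ p
  (a ∷ p) +ₚ (b ∷ q) = a + b ∷ p +ₚ q

  _*ₚ_ : List Carrier → List Carrier → List Carrier
  []      *ₚ q = []
  (a ∷ p) *ₚ q = map (a *_) q +ₚ (0# ∷ p *ₚ q)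

  evalU-+ₚ : ∀ p q x → evalU (p +ₚ q) x ≈ evalU p x + evalU q x
  evalU-+ₚ []      q       x = sym (+-identityˡ _)
  evalU-+ₚ (a ∷ p) []      x = sym (+-identityʳ _)
  evalU-+ₚ (a ∷ p) (b ∷ q) x = begin
    a + b + x * evalU (p +ₚ q) x           ≈⟨ +-congˡ (*-congˡ (evalU-+ₚ p q x)) ⟩
    a + b + x * (evalU p x + evalU q x)    ≈⟨ solve 5 (λ a b x u v →
                                                a :+ b :+ x :* (u :+ v) := a :+ x :* u :+ (b :+ x :* v))
                                                refl a b x (evalU p x) (evalU q x) ⟩
    a + x * evalU p x + (b + x * evalU q x) ∎

  evalU-map-* : ∀ c q x → evalU (map (c *_) q) x ≈ c * evalU q x
  evalU-map-* c []      x = sym (zeroʳ c)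
  evalU-map-* c (a ∷ q) x = begin
    c * a + x * evalU (map (c *_) q) x  ≈⟨ +-congˡ (*-congˡ (evalU-map-* c q x)) ⟩
    c * a + x * (c * evalU q x)         ≈⟨ solve 4 (λ c a x u → c :* a :+ x :* (c :* u) := c :* (a :+ x :* u))
                                                   refl c a x (evalU q x) ⟩
    c * (a + x * evalU q x)             ∎

  evalU-*ₚ : ∀ p q x → evalU (p *ₚ q) x ≈ evalU p x * evalU q x
  evalU-*ₚ []      q x = sym (zeroˡ _)
  evalU-*ₚ (a ∷ p) q x = begin
    evalU (map (a *_) q +ₚ (0# ∷ p *ₚ q)) x          ≈⟨ evalU-+ₚ (map (a *_) q) (0# ∷ p *ₚ q) x ⟩
    evalU (map (a *_) q) x + (0# + x * evalU (p *ₚ q) x)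
      ≈⟨ +-cong (evalU-map-* a q x) (trans (+-identityˡ _) (*-congˡ (evalU-*ₚ p q x))) ⟩
    a * evalU q x + x * (evalU p x * evalU q x)
      ≈⟨ solve 4 (λ a x u v → a :* v :+ x :* (u :* v) := (a :+ x :* u) :* v) refl a x (evalU p x) (evalU q x) ⟩
    (a + x * evalU p x) * evalU q x                  ∎

  IsPolynomial : (Carrier → Carrier) → Set
  IsPolynomial f = ∃ λ cs → ∀ x → f x ≈ evalU cs x

  const-isPolynomial : ∀ c → IsPolynomial (λ _ → c)
  const-isPolynomial c = c ∷ [] , λ x → sym (trans (+-congˡ (zeroʳ x)) (+-identityʳ c))

  id-isPolynomial : IsPolynomial (λ x → x)
  id-isPolynomial = 0# ∷ 1# ∷ [] , λ x → sym (begin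
    0# + x * (1# + x * 0#)  ≈⟨ +-identityˡ _ ⟩
    x * (1# + x * 0#)       ≈⟨ *-congˡ (trans (+-congˡ (zeroʳ x)) (+-identityʳ 1#)) ⟩
    x * 1#                  ≈⟨ *-identityʳ x ⟩
    x                       ∎)

  +-isPolynomial : ∀ {f g} → IsPolynomial f → IsPolynomial g → IsPolynomial (λ x → f x + g x)
  +-isPolynomial (p , f≈p) (q , g≈q) = p +ₚ q , λ x → trans (+-cong (f≈p x) (g≈q x)) (sym (evalU-+ₚ p q x))

  *-isPolynomial : ∀ {f g} → IsPolynomial f → IsPolynomial g → IsPolynomial (λ x → f x * g x)
  *-isPolynomial (p , f≈p) (q , g≈q) = p *ₚ q , λ x → trans (*-cong (f≈p x) (g≈q x)) (sym (evalU-*ₚ p q x))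

  -‿isPolynomial : ∀ {f} → IsPolynomial f → IsPolynomial (λ x → - f x)
  -‿isPolynomial f-poly with *-isPolynomial (const-isPolynomial (- 1#)) f-poly
  ... | p , -f≈p = p , λ x → trans (sym (-1*x≈-x _)) (-f≈p x)

  -- Synthetic division: for every c, horner a cs is the quotient of c + x·cs(x) by x − a.
  horner : Carrier → List Carrier → List Carrier
  horner a []       = []
  horner a (c ∷ cs) = evalU (c ∷ cs) a ∷ horner a cs

  length-horner : ∀ a cs → length (horner a cs) ≡ length cs
  length-horner a []       = ≡.refl
  length-horner a (c ∷ cs) = ≡.cong suc (length-horner a cs)

  horner-division : ∀ a x c cs →
    evalU (c ∷ cs) x + a * evalU (horner a cs) x ≈ evalU (c ∷ cs) a + x * evalU (horner a cs) x
  horner-division a x c []        =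
    solve 4 (λ a x c z → c :+ x :* z :+ a :* z := c :+ a :* z :+ x :* z) refl a x c 0#
  horner-division a x c (c′ ∷ cs) = begin
    c + x * r x + a * (r a + x * q)  ≈⟨ solve 6 (λ a x c rx ra q →
                                          c :+ x :* rx :+ a :* (ra :+ x :* q) := c :+ a :* ra :+ x :* (rx :+ a :* q))
                                          refl a x c (r x) (r a) q ⟩
    c + a * r a + x * (r x + a * q)  ≈⟨ +-congˡ (*-congˡ (horner-division a x c′ cs)) ⟩
    c + a * r a + x * (r a + x * q)  ∎
    where
    r : Carrier → Carrier
    r = evalU (c′ ∷ cs)
    q : Carrier
    q = evalU (horner a cs) x

  fromℕ-+ : ∀ m n → fromℕ (m ℕ.+ n) ≈ fromℕ m + fromℕ n
  fromℕ-+ zero    n = sym (+-identityˡ _)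
  fromℕ-+ (suc m) n = trans (+-congˡ (fromℕ-+ m n)) (sym (+-assoc _ _ _))

  module _ (fromℕ-suc-regular : ∀ k {z} → fromℕ (suc k) * z ≈ 0# → z ≈ 0#) where

    -- Dividing by x − N, the quotient vanishes from N + 1 on, since fromℕ (suc k) is not a zero divisor.
    vanishesAbove⇒vanishes : ∀ L cs → length cs ≡ L → ∀ N → (∀ k → evalU cs (fromℕ (k ℕ.+ N)) ≈ 0#) →
                             ∀ x → evalU cs x ≈ 0#
    vanishesAbove⇒vanishes _       []       _  N p≈0 x = refl
    vanishesAbove⇒vanishes (suc L) (c ∷ cs) eq N p≈0 x = begin
      evalU (c ∷ cs) x                           ≈⟨ sym (+-identityʳ _) ⟩
      evalU (c ∷ cs) x + 0#                      ≈⟨ +-congˡ (sym (trans (*-congˡ (q≈0 x)) (zeroʳ a))) ⟩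
      evalU (c ∷ cs) x + a * evalU q x           ≈⟨ horner-division a x c cs ⟩
      evalU (c ∷ cs) a + x * evalU q x           ≈⟨ +-cong (p≈0 0) (trans (*-congˡ (q≈0 x)) (zeroʳ x)) ⟩
      0# + 0#                                    ≈⟨ +-identityʳ 0# ⟩
      0#                                         ∎
      where
      a : Carrier
      a = fromℕ N
      q : List Carrier
      q = horner a cs
      q≈0-above : ∀ k → evalU q (fromℕ (suc k ℕ.+ N)) ≈ 0#
      q≈0-above k = fromℕ-suc-regular k (+-identityʳ-unique (a * evalU q y) _ (begin
          a * evalU q y + fromℕ (suc k) * evalU q y  ≈⟨ trans (+-comm _ _) (sym (distribʳ _ _ _)) ⟩
          (fromℕ (suc k) + a) * evalU q y            ≈⟨ *-congʳ (sym (fromℕ-+ (suc k) N)) ⟩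
          y * evalU q y                              ≈⟨ sym (+-identityˡ _) ⟩
          0# + y * evalU q y                         ≈⟨ +-congʳ (sym (p≈0 0)) ⟩
          evalU (c ∷ cs) a + y * evalU q y           ≈⟨ sym (horner-division a y c cs) ⟩
          evalU (c ∷ cs) y + a * evalU q y           ≈⟨ +-congʳ (p≈0 (suc k)) ⟩
          0# + a * evalU q y                         ≈⟨ +-identityˡ _ ⟩
          a * evalU q y                              ∎))
        where
        y : Carrier
        y = fromℕ (suc k ℕ.+ N)
      q≈0 : ∀ x → evalU q x ≈ 0#
      q≈0 = vanishesAbove⇒vanishes L q (≡.trans (length-horner a cs) (ℕ.suc-injective eq)) (suc N)
        (λ k → ≡.subst (λ n → evalU q (fromℕ n) ≈ 0#) (≡.sym (ℕ.+-suc k N)) (q≈0-above k))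

    vanishesOnℕ⇒vanishes : ∀ {f} → IsPolynomial f → (∀ k → f (fromℕ k) ≈ 0#) → ∀ x → f x ≈ 0#
    vanishesOnℕ⇒vanishes (cs , f≈cs) f≈0 x = trans (f≈cs x) (vanishesAbove⇒vanishes _ cs ≡.refl 0 cs≈0 x)
      where
      cs≈0 : ∀ k → evalU cs (fromℕ (k ℕ.+ 0)) ≈ 0#
      cs≈0 k rewrite ℕ.+-identityʳ k = trans (sym (f≈cs _)) (f≈0 k)

    agreeOnℕ⇒agree : ∀ {f g} → IsPolynomial f → IsPolynomial g → (∀ k → f (fromℕ k) ≈ g (fromℕ k)) →
                     ∀ x → f x ≈ g x
    agreeOnℕ⇒agree f-poly g-poly f≈g x = x∙y⁻¹≈ε⇒x≈y _ _
      (vanishesOnℕ⇒vanishes (+-isPolynomial f-poly (-‿isPolynomial g-poly)) (x≈y⇒x∙y⁻¹≈ε ∘ f≈g) x)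

module _ (𝔸 : AlgebraicNumbers) where
  open AlgebraicNumbers 𝔸
  open WithA 𝔸
  open CommutativeRing 𝔸ring
    using (refl; reflexive; sym; trans; setoid; semiring; commutativeSemiring;
           +-cong; +-congˡ; +-congʳ; +-identityˡ; +-identityʳ;
           *-cong; *-congˡ; *-congʳ; *-identityˡ; *-identityʳ; *-assoc; *-comm; zeroˡ; zeroʳ)
  open Univariate 𝔸ring using (IsPolynomial; const-isPolynomial; id-isPolynomial;
                               +-isPolynomial; *-isPolynomial; agreeOnℕ⇒agree)
  open import Algebra.Properties.Semiring.Sum semiring
    using (sum-syntax; sum-cong-≋; sum-remove; sum-replicate-zero; ∑-comm; *-distribˡ-sum)
  open import Algebra.Solver.Ring.NaturalCoefficients.Default commutativeSemiring using (solve; _:*_; _:=_)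
  open import Relation.Binary.Reasoning.Setoid setoid

  fromℕ-suc-regular : ∀ k {z} → fromℕ (suc k) * z ≈ 0# → z ≈ 0#
  fromℕ-suc-regular k {z} k*z≈0 with inverse (fromℕ (suc k)) (char0 k)
  ... | k⁻¹ , k*k⁻¹≈1 = begin
    z                          ≈⟨ sym (*-identityˡ z) ⟩
    1# * z                     ≈⟨ *-congʳ (sym k*k⁻¹≈1) ⟩
    fromℕ (suc k) * k⁻¹ * z    ≈⟨ trans (*-congʳ (*-comm _ _)) (*-assoc _ _ _) ⟩
    k⁻¹ * (fromℕ (suc k) * z)  ≈⟨ *-congˡ k*z≈0 ⟩
    k⁻¹ * 0#                   ≈⟨ zeroʳ k⁻¹ ⟩
    0#                         ∎

  eval-cong : ∀ {d} {σ ρ : Fin d → Carrier} → (∀ k → σ k ≈ ρ k) → ∀ t → eval σ t ≈ eval ρ t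
  eval-cong σ≈ρ (con c) = refl
  eval-cong σ≈ρ (var x) = σ≈ρ x
  eval-cong σ≈ρ (s ⊕ t) = +-cong (eval-cong σ≈ρ s) (eval-cong σ≈ρ t)
  eval-cong σ≈ρ (s ⊗ t) = *-cong (eval-cong σ≈ρ s) (eval-cong σ≈ρ t)

  instHead : ∀ {d} → Carrier → Term Carrier (suc d) → Term Carrier d
  instHead x (con c)       = con c
  instHead x (var zero)    = con x
  instHead x (var (suc k)) = var k
  instHead x (s ⊕ t)       = instHead x s ⊕ instHead x t
  instHead x (s ⊗ t)       = instHead x s ⊗ instHead x t

  eval-instHead : ∀ {d} (σ : Fin (suc d) → Carrier) t → eval (tail σ) (instHead (head σ) t) ≡ eval σ t
  eval-instHead σ (con c)       = ≡.refl
  eval-instHead σ (var zero)    = ≡.refl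
  eval-instHead σ (var (suc k)) = ≡.refl
  eval-instHead σ (s ⊕ t)       = ≡.cong₂ _+_ (eval-instHead σ s) (eval-instHead σ t)
  eval-instHead σ (s ⊗ t)       = ≡.cong₂ _*_ (eval-instHead σ s) (eval-instHead σ t)

  instHead-isPolynomial : ∀ {d} (σ : Fin d → Carrier) t → IsPolynomial (λ x → eval σ (instHead x t))
  instHead-isPolynomial σ (con c)       = const-isPolynomial c
  instHead-isPolynomial σ (var zero)    = id-isPolynomial
  instHead-isPolynomial σ (var (suc k)) = const-isPolynomial (σ k)
  instHead-isPolynomial σ (s ⊕ t)       = +-isPolynomial (instHead-isPolynomial σ s) (instHead-isPolynomial σ t)
  instHead-isPolynomial σ (s ⊗ t)       = *-isPolynomial (instHead-isPolynomial σ s) (instHead-isPolynomial σ t)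

  eval-agreeOnℕ⇒agree : ∀ {d} (s t : Term Carrier d) →
                        (∀ (τ : Fin d → ℕ) → eval (fromℕ ∘ τ) s ≈ eval (fromℕ ∘ τ) t) →
                        ∀ σ → eval σ s ≈ eval σ t
  eval-agreeOnℕ⇒agree {zero} s t s≈t σ = trans (eval-cong (λ ()) s) (trans (s≈t (λ ())) (eval-cong (λ ()) t))
  eval-agreeOnℕ⇒agree {suc d} s t s≈t σ = begin
    eval σ s                             ≡⟨ eval-instHead σ s ⟨
    eval (tail σ) (instHead (head σ) s)
      ≈⟨ agreeOnℕ⇒agree fromℕ-suc-regular (instHead-isPolynomial (tail σ) s) (instHead-isPolynomial (tail σ) t)
           (λ j → eval-agreeOnℕ⇒agree (instHead (fromℕ j) s) (instHead (fromℕ j) t) (at j) (tail σ)) (head σ) ⟩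
    eval (tail σ) (instHead (head σ) t)  ≡⟨ eval-instHead σ t ⟩
    eval σ t                             ∎
    where
    at : ∀ j (τ : Fin d → ℕ) → eval (fromℕ ∘ τ) (instHead (fromℕ j) s) ≈ eval (fromℕ ∘ τ) (instHead (fromℕ j) t)
    at j τ rewrite eval-instHead (fromℕ ∘ (j Vector.∷ τ)) s | eval-instHead (fromℕ ∘ (j Vector.∷ τ)) t =
      s≈t (j Vector.∷ τ)

  atStep : ∀ {d} → ℕ → PE Carrier d → Term Carrier d
  atStep n (con c)  = con c
  atStep n (var x)  = var x
  atStep n (nb a b) = con ((fromℕ n ^ᴬ a) * (b ^ᴬ n))
  atStep n (s ⊕ t)  = atStep n s ⊕ atStep n t
  atStep n (s ⊗ t)  = atStep n s ⊗ atStep n t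

  eval-atStep : ∀ {d} σ n (e : PE Carrier d) → eval σ (atStep n e) ≡ evalPE σ n e
  eval-atStep σ n (con c)  = ≡.refl
  eval-atStep σ n (var x)  = ≡.refl
  eval-atStep σ n (nb a b) = ≡.refl
  eval-atStep σ n (s ⊕ t)  = ≡.cong₂ _+_ (eval-atStep σ n s) (eval-atStep σ n t)
  eval-atStep σ n (s ⊗ t)  = ≡.cong₂ _*_ (eval-atStep σ n s) (eval-atStep σ n t)

  closedForm-everywhere : ∀ {d} {η : Update Carrier d} {cl n₀ n} → IsClosedForm η cl n₀ → n₀ ℕ.≤ n →
                          ∀ σ w → evalPE σ n (cl w) ≈ eval σ (powU η n w)
  closedForm-everywhere {η = η} {cl} {n = n} closed n₀≤n σ w = begin
    evalPE σ n (cl w)           ≡⟨ eval-atStep σ n (cl w) ⟨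
    eval σ (atStep n (cl w))    ≈⟨ eval-agreeOnℕ⇒agree (atStep n (cl w)) (powU η n w) onℕ σ ⟩
    eval σ (powU η n w)         ∎
    where
    onℕ : ∀ τ → eval (fromℕ ∘ τ) (atStep n (cl w)) ≈ eval (fromℕ ∘ τ) (powU η n w)
    onℕ τ rewrite eval-atStep (fromℕ ∘ τ) n (cl w) = closed (λ k → ℤ.+ τ k) n n₀≤n w

  eval-substT : ∀ {d} {σ ρ : Fin d → Carrier} (η : Update Carrier d) → (∀ w → eval σ (η w) ≈ ρ w) →
                ∀ t → eval σ (substT η t) ≈ eval ρ t
  eval-substT η η≈ρ (con c) = refl
  eval-substT η η≈ρ (var x) = η≈ρ x
  eval-substT η η≈ρ (s ⊕ t) = +-cong (eval-substT η η≈ρ s) (eval-substT η η≈ρ t)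
  eval-substT η η≈ρ (s ⊗ t) = *-cong (eval-substT η η≈ρ s) (eval-substT η η≈ρ t)

  evalPE-substPE : ∀ {d} {σ ρ : Fin d → Carrier} {n} (f : Fin d → PE Carrier d) →
                   (∀ w → evalPE σ n (f w) ≈ ρ w) → ∀ e → evalPE σ n (substPE f e) ≈ evalPE ρ n e
  evalPE-substPE f f≈ρ (con c)  = refl
  evalPE-substPE f f≈ρ (var x)  = f≈ρ x
  evalPE-substPE f f≈ρ (nb a b) = refl
  evalPE-substPE f f≈ρ (s ⊕ t)  = +-cong (evalPE-substPE f f≈ρ s) (evalPE-substPE f f≈ρ t)
  evalPE-substPE f f≈ρ (s ⊗ t)  = *-cong (evalPE-substPE f f≈ρ s) (evalPE-substPE f f≈ρ t)

  evalPE-toPE : ∀ {d} σ n (t : Term Carrier d) → evalPE σ n (toPE t) ≡ eval σ t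
  evalPE-toPE σ n (con c) = ≡.refl
  evalPE-toPE σ n (var x) = ≡.refl
  evalPE-toPE σ n (s ⊕ t) = ≡.cong₂ _+_ (evalPE-toPE σ n s) (evalPE-toPE σ n t)
  evalPE-toPE σ n (s ⊗ t) = ≡.cong₂ _*_ (evalPE-toPE σ n s) (evalPE-toPE σ n t)

  indicator : ∀ {P : Set} → Dec P → Carrier
  indicator (yes _) = 1#
  indicator (no _)  = 0#

  inBlock : ∀ {d m} → (Fin d → Fin m) → Fin m → Fin d → Carrier
  inBlock blk i k = indicator (blk k Fin.≟ i)

  inBlock-self : ∀ {d m} (blk : Fin d → Fin m) k → inBlock blk (blk k) k ≈ 1#
  inBlock-self blk k with blk k Fin.≟ blk k
  ... | yes _ = refl
  ... | no k∉ = contradiction ≡.refl k∉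

  inBlock-guard : ∀ {d m} (blk : Fin d → Fin m) i k {a b} → (blk k ≡ i → a ≈ b) →
                  inBlock blk i k * a ≈ inBlock blk i k * b
  inBlock-guard blk i k a≈b with blk k Fin.≟ i
  ... | yes k∈ = *-congˡ (a≈b k∈)
  ... | no _   = trans (zeroˡ _) (sym (zeroˡ _))

  bsum≈∑ : ∀ {d m} (blk : Fin d → Fin m) i f → bsum blk i f ≈ ∑[ k < d ] (inBlock blk i k * f k)
  bsum≈∑ {zero}  blk i f = refl
  bsum≈∑ {suc d} blk i f with blk zero Fin.≟ i
  ... | yes _ = +-cong (sym (*-identityˡ _)) (bsum≈∑ (tail blk) i (tail f))
  ... | no _  = trans (bsum≈∑ (tail blk) i (tail f)) (sym (trans (+-congʳ (zeroˡ _)) (+-identityˡ _)))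

  δ-refl : ∀ {d} (v : Fin d) → δ v v ≈ 1#
  δ-refl v with v Fin.≟ v
  ... | yes _ = refl
  ... | no v≢v = contradiction ≡.refl v≢v

  δ-≢ : ∀ {d} {v w : Fin d} → v ≢ w → δ v w ≈ 0#
  δ-≢ {v = v} {w} v≢w with v Fin.≟ w
  ... | yes v≡w = contradiction v≡w v≢w
  ... | no _    = refl

  ∑-δ : ∀ {d} (v : Fin d) (h : Fin d → Carrier) → ∑[ l < d ] (h l * δ v l) ≈ h v
  ∑-δ {suc d} v h = begin
    ∑[ l < suc d ] (h l * δ v l)                 ≈⟨ sum-remove {i = v} (λ l → h l * δ v l) ⟩
    h v * δ v v + ∑[ l < d ] (h (punchIn v l) * δ v (punchIn v l))
      ≈⟨ +-cong (trans (*-congˡ (δ-refl v)) (*-identityʳ _))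
                (trans (sum-cong-≋ (λ l → trans (*-congˡ (δ-≢ (punchInᵢ≢i v l ∘ ≡.sym))) (zeroʳ _)))
                       (sum-replicate-zero d)) ⟩
    h v + 0#                                     ≈⟨ +-identityʳ _ ⟩
    h v                                          ∎

  eval-bigT : ∀ {d} σ n (f : Fin n → Term Carrier d) → eval σ (bigT 0# n f) ≡ ∑[ k < n ] eval σ (f k)
  eval-bigT σ zero    f = ≡.refl
  eval-bigT σ (suc n) f = ≡.cong (eval σ (f zero) +_) (eval-bigT σ n (tail f))

  -- The summands of blockLin are local to its definition; unification recovers them.
  summands : ∀ {C : Set} {d} {z : C} (t : Term C d) {f : Fin d → Term C d} → t ≡ bigT z d f → Fin d → Term C d
  summands _ {f} _ = f

  eval-blockLin : ∀ {d m} (blk : Fin d → Fin m) M j {i} → blk j ≡ i →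
                  ∀ σ → eval σ (blockLin 0# blk M j) ≈ ∑[ k < d ] (inBlock blk i k * (M j k * σ k))
  eval-blockLin {d} blk M j ≡.refl σ =
    trans (reflexive (eval-bigT σ d (summands (blockLin 0# blk M j) ≡.refl))) (sum-cong-≋ summand)
    where
    summand : ∀ k → eval σ (summands (blockLin 0# blk M j) ≡.refl k) ≈ inBlock blk (blk j) k * (M j k * σ k)
    summand k with blk k Fin.≟ blk j
    ... | yes _ = sym (*-identityˡ _)
    ... | no _  = sym (zeroˡ _)

  ⟦_⟧ : ∀ {d} → Update Carrier d → (Fin d → Carrier) → Fin d → Carrier
  ⟦ η ⟧ σ w = eval σ (η w)

  ϑ-leftInverse : ∀ {d m} {blk : Fin d → Fin m} {P Pinv} → BlockInverse blk P Pinv →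
                  ∀ σ v → ⟦ ϑ blk Pinv ⟧ (⟦ ϑ blk P ⟧ σ) v ≈ σ v
  ϑ-leftInverse {d} {blk = blk} {P} {Pinv} inverse σ v = begin
    ⟦ ϑ blk Pinv ⟧ (⟦ ϑ blk P ⟧ σ) v
      ≈⟨ eval-blockLin blk Pinv v ≡.refl (⟦ ϑ blk P ⟧ σ) ⟩
    ∑[ k < d ] (χ k * (Pinv v k * ⟦ ϑ blk P ⟧ σ k))
      ≈⟨ sum-cong-≋ (λ k → inBlock-guard blk (blk v) k (λ k∈ → *-congˡ (eval-blockLin blk P k k∈ σ))) ⟩
    ∑[ k < d ] (χ k * (Pinv v k * ∑[ l < d ] (χ l * (P k l * σ l))))
      ≈⟨ sum-cong-≋ expand ⟩
    ∑[ k < d ] ∑[ l < d ] (χ l * σ l * (χ k * (Pinv v k * P k l)))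
      ≈⟨ ∑-comm (λ k l → χ l * σ l * (χ k * (Pinv v k * P k l))) ⟩
    ∑[ l < d ] ∑[ k < d ] (χ l * σ l * (χ k * (Pinv v k * P k l)))
      ≈⟨ sum-cong-≋ (λ l → sym (*-distribˡ-sum (χ l * σ l) (λ k → χ k * (Pinv v k * P k l)))) ⟩
    ∑[ l < d ] (χ l * σ l * ∑[ k < d ] (χ k * (Pinv v k * P k l)))
      ≈⟨ sum-cong-≋ (λ l → trans (*-assoc _ _ _) (trans
           (inBlock-guard blk (blk v) l (*-congˡ ∘ Pinv·P≈δ l)) (sym (*-assoc _ _ _)))) ⟩
    ∑[ l < d ] (χ l * σ l * δ v l)
      ≈⟨ ∑-δ v (λ l → χ l * σ l) ⟩
    χ v * σ v
      ≈⟨ trans (*-congʳ (inBlock-self blk v)) (*-identityˡ _) ⟩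
    σ v ∎
    where
    χ : Fin d → Carrier
    χ = inBlock blk (blk v)
    expand : ∀ k → χ k * (Pinv v k * ∑[ l < d ] (χ l * (P k l * σ l))) ≈
                   ∑[ l < d ] (χ l * σ l * (χ k * (Pinv v k * P k l)))
    expand k = trans (*-congˡ (*-distribˡ-sum (Pinv v k) (λ l → χ l * (P k l * σ l))))
      (trans (*-distribˡ-sum (χ k) (λ l → Pinv v k * (χ l * (P k l * σ l)))) (sum-cong-≋ (λ l →
        solve 5 (λ a b c e f → a :* (b :* (c :* (e :* f))) := c :* f :* (a :* (b :* e))) refl
          (χ k) (Pinv v k) (χ l) (P k l) (σ l))))
    Pinv·P≈δ : ∀ l → blk l ≡ blk v → ∑[ k < d ] (χ k * (Pinv v k * P k l)) ≈ δ v l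
    Pinv·P≈δ l l∈ = trans (sym (bsum≈∑ blk (blk v) _)) (proj₂ (inverse v l (≡.sym l∈)))

  powU-conj : ∀ {d} (θ η ζ : Update Carrier d) → (∀ σ w → ⟦ η ⟧ (⟦ θ ⟧ σ) w ≈ ⟦ θ ⟧ (⟦ ζ ⟧ σ) w) →
              ∀ n σ w → ⟦ powU η n ⟧ (⟦ θ ⟧ σ) w ≈ ⟦ θ ⟧ (⟦ powU ζ n ⟧ σ) w
  powU-conj θ η ζ conj zero    σ w = refl
  powU-conj θ η ζ conj (suc n) σ w = begin
    eval (⟦ θ ⟧ σ) (substT η (powU η n w))   ≈⟨ eval-substT η (conj σ) (powU η n w) ⟩
    ⟦ powU η n ⟧ (⟦ θ ⟧ (⟦ ζ ⟧ σ)) w         ≈⟨ powU-conj θ η ζ conj n (⟦ ζ ⟧ σ) w ⟩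
    ⟦ θ ⟧ (⟦ powU ζ n ⟧ (⟦ ζ ⟧ σ)) w         ≈⟨ eval-cong (λ u → sym (eval-substT ζ (λ _ → refl) (powU ζ n u))) (θ w) ⟩
    ⟦ θ ⟧ (⟦ powU ζ (suc n) ⟧ σ) w           ∎

  closedForm-conj : ∀ {d m} (blk : Fin d → Fin m) P Pinv → BlockInverse blk P Pinv → ∀ ηs clt n₀ →
                    IsClosedForm (ηt blk P Pinv ηs) clt n₀ → IsClosedForm (mapT fromℤ ∘ ηs) (cls blk P Pinv clt) n₀
  closedForm-conj blk P Pinv inverse ηs clt n₀ closed σ n n₀≤n i = begin
    evalPE s n (cls blk P Pinv clt i)
      ≈⟨ evalPE-substPE (toPE ∘ θ) (λ w → reflexive (evalPE-toPE s n (θ w))) (substPE clt (toPE (θ⁻¹ i))) ⟩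
    evalPE (⟦ θ ⟧ s) n (substPE clt (toPE (θ⁻¹ i)))
      ≈⟨ evalPE-substPE clt (closedForm-everywhere {η = ηT} {clt} closed n₀≤n (⟦ θ ⟧ s)) (toPE (θ⁻¹ i)) ⟩
    evalPE (⟦ powU ηT n ⟧ (⟦ θ ⟧ s)) n (toPE (θ⁻¹ i))
      ≡⟨ evalPE-toPE _ n (θ⁻¹ i) ⟩
    ⟦ θ⁻¹ ⟧ (⟦ powU ηT n ⟧ (⟦ θ ⟧ s)) i
      ≈⟨ eval-cong (powU-conj θ ηT ηS ηT-conj n s) (θ⁻¹ i) ⟩
    ⟦ θ⁻¹ ⟧ (⟦ θ ⟧ (⟦ powU ηS n ⟧ s)) i
      ≈⟨ ϑ-leftInverse inverse _ i ⟩
    ⟦ powU ηS n ⟧ s i ∎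
    where
    s : Fin _ → Carrier
    s = fromℤ ∘ σ
    θ θ⁻¹ ηS ηT : Update Carrier _
    θ   = ϑ blk P
    θ⁻¹ = ϑ blk Pinv
    ηS  = mapT fromℤ ∘ ηs
    ηT  = ηt blk P Pinv ηs
    ηT-conj : ∀ σ w → ⟦ ηT ⟧ (⟦ θ ⟧ σ) w ≈ ⟦ θ ⟧ (⟦ ηS ⟧ σ) w
    ηT-conj σ w = eval-substT (θ⁻¹ ⊙ ηS) (λ u → eval-substT θ⁻¹ (ϑ-leftInverse inverse σ) (ηS u)) (θ w)

theorem1 : (𝔸 : AlgebraicNumbers) → ∀ {d m : ℕ} →
    (blk : Fin d → Fin m) → WithA.IsPartition 𝔸 blk →
    (ηs : Update ℤ d) (A : Fin d → Fin d → ℤ) (p : Fin d → Term ℤ d) →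
    WithA.SolvableWith 𝔸 blk ηs A p →
    (P Pinv : Fin d → Fin d → WithA.Carrier 𝔸) →
    WithA.BlockInverse 𝔸 blk P Pinv →
    (∀ i → WithA.IsJordanNF 𝔸 blk (WithA.conj 𝔸 blk P A Pinv) i) →
    WithA.IsTwn 𝔸 (WithA.ηt 𝔸 blk P Pinv ηs) →
    (clt : Fin d → PE (WithA.Carrier 𝔸) d) (n₀ : ℕ) →
    WithA.IsClosedForm 𝔸 (WithA.ηt 𝔸 blk P Pinv ηs) clt n₀ →
    WithA.IsClosedForm 𝔸 (mapT (WithA.fromℤ 𝔸) ∘ ηs)
    (WithA.cls 𝔸 blk P Pinv clt) n₀
-- Only the invertibility of the P_S matters here: solvability, the Jordan form and the twn property
-- are what make a closed form of η_t exist, not what makes it transfer to η_s.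
theorem1 𝔸 blk _ ηs _ _ _ P Pinv inverse _ _ clt n₀ = closedForm-conj 𝔸 blk P Pinv inverse ηs clt n₀
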